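{- The map $\Lambda\mapsto\Lambda^+$ is rank inverting on $\widetilde{\mathrm{NC}}^B(n)$: if $\Lambda\in\widetilde{\mathrm{NC}}^B(n)$ has $2k+1$ blocks, then $\Lambda^+\in\widetilde{\mathrm{NC}}^B(n)$ has $2(n-k)+1$ blocks.
   Context: For a set partition $\Lambda$ of a finite set $X\subset\mathbb{Z}$, $(i,j)$ with $i<j$ is an arc if $i,j$ share a block and $j$ is the least element of that block greater than $i$; $\mathrm{Arc}(\Lambda)$ is the set of arcs (it determines $\Lambda$). $\Lambda^+$ is the partition of $X$ with arc set $(\mathrm{Arc}(\Lambda)\setminus\mathcal{S})\cup\mathcal{T}$, where $\mathcal{S}=\{(i,i+1):i\in\mathbb{Z}\}$ and $\mathcal{T}$ is the set of pairs $(i,i+1)\in X\times X$ with $i$ maximal in its block and $i+1$ minimal in its block. Let $[\pm n]=\{\pm1,\dots,\pm n\}$ and $-\Lambda=\{ -B:B\in\Lambda\}$. $\Pi^B(n)$ is the set of partitions $\Lambda$ of $\{0\}\cup[\pm n]$ with $-\Lambda=\Lambda$ in which the only block $B$ with $B=-B$ is the block containing $0$. $\widetilde{\mathrm{NC}}^B(n)$ is the set of $\Lambda\in\Pi^B(n)$ such that whenever $(i,k),(j,l)\in\mathrm{Arc}(\Lambda)$ with $i<j<k<l$ one has $(i,k)=(-l,-j)$. -}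

module Defs where

open import Data.Nat using (ℕ; zero; suc)
open import Data.Integer using (ℤ; +_; -_; _<_; _≤_; _+_; 1ℤ)
open import Data.List using (List; []; _∷_; concat; length)
open import Data.List.Membership.Propositional using (_∈_)
open import Data.List.Relation.Unary.All using (All)
open import Data.List.Relation.Binary.Permutation.Propositional using (_↭_)
open import Data.Product using (_×_; ∃-syntax)
open import Data.Sum using (_⊎_)
open import Relation.Binary.PropositionalEquality using (_≡_; _≢_)

-- The ground set {0} ∪ [±n], listed once each.
elems : ℕ → List ℤ
elems zero = + 0 ∷ []
elems (suc n) = + suc n ∷ - (+ suc n) ∷ elems n

InX : ℕ → ℤ → Set
InX n x = x ∈ elems n

NonEmpty : List ℤ → Set
NonEmpty B = ∃[ x ] (x ∈ B)

-- A set partition of {0} ∪ [±n]: a list of nonempty blocks such that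
-- the blocks together contain every element of {0} ∪ [±n] exactly once.
record Partition (n : ℕ) : Set where
  constructor mkPartition
  field
    blocks   : List (List ℤ)
    nonempty : All NonEmpty blocks
    covers   : concat blocks ↭ elems n
open Partition public

#blocks : ∀ {n} → Partition n → ℕ
#blocks Λ = length (blocks Λ)

SameBlock : ∀ {n} → Partition n → ℤ → ℤ → Set
SameBlock Λ i j = ∃[ B ] (B ∈ blocks Λ × i ∈ B × j ∈ B)

Arc : ∀ {n} → Partition n → ℤ → ℤ → Set
Arc Λ i j = i < j × (∃[ B ] (B ∈ blocks Λ × i ∈ B × j ∈ B ×
              (∀ m → m ∈ B → i < m → j ≤ m)))

MaxInBlock : ∀ {n} → Partition n → ℤ → Set
MaxInBlock Λ i = ∀ m → SameBlock Λ i m → m ≤ i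

MinInBlock : ∀ {n} → Partition n → ℤ → Set
MinInBlock Λ i = ∀ m → SameBlock Λ i m → i ≤ m

-- (i , j) ∈ (Arc(Λ) \ S) ∪ T
PlusArc : ∀ {n} → Partition n → ℤ → ℤ → Set
PlusArc {n} Λ i j =
  (Arc Λ i j × j ≢ i + 1ℤ)
  ⊎ (j ≡ i + 1ℤ × InX n i × InX n j × MaxInBlock Λ i × MinInBlock Λ j)

-- Λ′ has arc set (Arc(Λ) \ S) ∪ T, i.e. Λ′ = Λ⁺
IsPlus : ∀ {n} → Partition n → Partition n → Set
IsPlus Λ Λ′ = ∀ i j → (Arc Λ′ i j → PlusArc Λ i j) × (PlusArc Λ i j → Arc Λ′ i j)

SameSet : List ℤ → List ℤ → Set
SameSet A B = ∀ x → (x ∈ A → x ∈ B) × (x ∈ B → x ∈ A)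

negList : List ℤ → List ℤ
negList [] = []
negList (x ∷ xs) = - x ∷ negList xs

InPiB : ∀ {n} → Partition n → Set
InPiB Λ =
  -- −Λ = Λ  (every negated block is a block; this suffices since blocks are finite in number and negation is an involution)
  (∀ B → B ∈ blocks Λ → ∃[ B′ ] (B′ ∈ blocks Λ × SameSet B′ (negList B)))
  × (∀ B → B ∈ blocks Λ → SameSet B (negList B) → + 0 ∈ B)

InNCB : ∀ {n} → Partition n → Set
InNCB Λ = InPiB Λ ×
  (∀ i j k l → Arc Λ i k → Arc Λ j l → i < j → j < k → k < l →
     (i ≡ - l × k ≡ - j))

module Submission where

-- Idea. Λ⁺ is determined by its arcs, so it is built from the arc relation
-- (Arc(Λ) \ S) ∪ T, which is increasing, functional and injective; any such relation on a
-- sorted list is the arc set of a partition, assembled from the top element down (Realise).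
-- Λ⁺ is noncrossing because its new arcs (i , i + 1) cross nothing, and symmetric because
-- negation maps arcs to arcs: same-block pairs are linked by chains of arcs, and a
-- self-negating block of Λ⁺ not containing 0 would contain an arc jumping over 0, which the
-- symmetry and the zero block of Λ rule out.
-- For the rank, count blocks by extreme elements (BlockCount): Λ⁺ has one block per maximum,
-- Λ one per minimum, and x is a maximum of Λ⁺ iff x + 1 is not a minimum of Λ (a crossing
-- argument). Shifting the count by one along [-n , n], where -n is always a minimum, gives
-- #blocks Λ⁺ + #blocks Λ = 2n + 2; with #blocks Λ = 2k + 1 this is 2(n - k) + 1.

open import Defs

module PlusMap where
  open import Data.Integer.Base using (ℤ; +_; -_; _+_; _-_; _<_; _≤_; +≤+; +<+; 1ℤ; 0ℤ; ∣_∣)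
  open import Data.Integer.Properties
  open import Data.Integer.Tactic.RingSolver using (solve-∀)
  import Data.Nat as ℕ
  import Data.Nat.Properties as ℕₚ
  open ℕ using (ℕ; zero; suc)
  open import Data.Bool using (Bool; true; false; not; _∧_)
  open import Data.List using (List; []; _∷_; _++_; [_]; concat; length)
  open import Data.List.Properties using (++-identityʳ)
  open import Data.List.Membership.Propositional using (_∈_; _∉_)
  open import Data.List.Membership.Propositional.Properties using (∈-concat⁺′; ∈-concat⁻′)
  open import Data.List.Membership.DecPropositional _≟_ using (_∈?_)
  open import Data.List.Relation.Unary.Any using (here; there)
  open import Data.List.Relation.Unary.All as All using (All; []; _∷_)
  open import Data.List.Relation.Unary.AllPairs using (AllPairs; []; _∷_)
  open import Data.List.Relation.Binary.Permutation.Propositional using (_↭_; ↭-refl; ↭-sym; ↭-trans; prep; swap; module PermutationReasoning)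
  open import Data.List.Relation.Binary.Permutation.Propositional.Properties using (++⁺ˡ; shift; ∈-resp-↭)
  open import Data.Product using (_×_; _,_; proj₁; proj₂; ∃-syntax)
  open import Data.Sum using (_⊎_; inj₁; inj₂)
  open import Data.Empty using (⊥; ⊥-elim)
  open import Function using (_∘_)
  open import Level using (0ℓ)
  open import Relation.Nullary using (¬_; Dec; yes; no; does)
  open import Relation.Binary using (Rel; IsDecTotalOrder; IsStrictTotalOrder; TotalOrder; tri<; tri≈; tri>)
  import Relation.Binary.Construct.Flip.EqAndOrd as Flip
  open import Relation.Binary.PropositionalEquality hiding ([_])
  open import Algebra.Bundles using (AbelianGroup)
  open import Algebra.Properties.Group (AbelianGroup.group +-0-abelianGroup) using (∙-cancelʳ)

  x<x+1 : ∀ x → x < x + 1ℤ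
  x<x+1 x = subst (x <_) (+-comm 1ℤ x) (suc[i]≤j⇒i<j ≤-refl)

  <⇒+1≤ : ∀ {x y} → x < y → x + 1ℤ ≤ y
  <⇒+1≤ {x} x<y = subst (_≤ _) (+-comm 1ℤ x) (i<j⇒suc[i]≤j x<y)

  nothing-between : ∀ {x y} → x < y → y < x + 1ℤ → ⊥
  nothing-between x<y y<x+1 = <⇒≱ y<x+1 (<⇒+1≤ x<y)

  <+1⇒≤ : ∀ {x y} → y < x + 1ℤ → y ≤ x
  <+1⇒≤ y<x+1 = ≮⇒≥ λ x<y → nothing-between x<y y<x+1

  -- x + 1 = -x is impossible: for x ≥ 0 we have -x < x + 1, for x < 0 we have x + 1 < -x.
  x+1≢-x : ∀ x → x + 1ℤ ≢ - x
  x+1≢-x x eq with 0ℤ ≤? x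
  ... | yes 0≤x = <-irrefl (sym eq) (≤-<-trans (≤-trans (neg-mono-≤ 0≤x) 0≤x) (x<x+1 x))
  ... | no x≱0  = <-irrefl eq (≤-<-trans (<⇒+1≤ x<0) (neg-mono-< x<0))
    where
    x<0 : x < 0ℤ
    x<0 = ≰⇒> x≱0

  neg-step : ∀ {i j} → j ≡ i + 1ℤ → - i ≡ - j + 1ℤ
  neg-step {i} refl = identity i
    where
    identity : ∀ i → - i ≡ - (i + 1ℤ) + 1ℤ
    identity = solve-∀

  neg-step⁻ : ∀ {i j} → - i ≡ - j + 1ℤ → j ≡ i + 1ℤ
  neg-step⁻ {i} {j} eq = subst₂ (λ a b → a ≡ b + 1ℤ) (neg-involutive j) (neg-involutive i) (neg-step eq)

  +1-injective : ∀ {i j} → i + 1ℤ ≡ j + 1ℤ → i ≡ j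
  +1-injective {i} {j} eq = ∙-cancelʳ 1ℤ i j eq

  bit : Bool → ℕ
  bit true  = 1
  bit false = 0

  count : (ℤ → Bool) → List ℤ → ℕ
  count p []       = 0
  count p (x ∷ xs) = bit (p x) ℕ.+ count p xs

  count-++ : ∀ p xs ys → count p (xs ++ ys) ≡ count p xs ℕ.+ count p ys
  count-++ p []       ys = refl
  count-++ p (x ∷ xs) ys = trans (cong (bit (p x) ℕ.+_) (count-++ p xs ys)) (sym (ℕₚ.+-assoc (bit (p x)) _ _))

  count-↭ : ∀ p {xs ys} → xs ↭ ys → count p xs ≡ count p ys
  count-↭ p _↭_.refl           = refl
  count-↭ p (prep x σ)         = cong (bit (p x) ℕ.+_) (count-↭ p σ)
  count-↭ p (swap x y σ)       = begin
    bit (p x) ℕ.+ (bit (p y) ℕ.+ _)  ≡⟨ ℕₚ.+-assoc (bit (p x)) _ _ ⟨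
    (bit (p x) ℕ.+ bit (p y)) ℕ.+ _  ≡⟨ cong₂ ℕ._+_ (ℕₚ.+-comm (bit (p x)) (bit (p y))) (count-↭ p σ) ⟩
    (bit (p y) ℕ.+ bit (p x)) ℕ.+ _  ≡⟨ ℕₚ.+-assoc (bit (p y)) _ _ ⟩
    bit (p y) ℕ.+ (bit (p x) ℕ.+ _)  ∎
    where open ≡-Reasoning
  count-↭ p (_↭_.trans σ τ)    = trans (count-↭ p σ) (count-↭ p τ)

  count-cong : ∀ p q xs → (∀ x → x ∈ xs → p x ≡ q x) → count p xs ≡ count q xs
  count-cong p q []       _    = refl
  count-cong p q (x ∷ xs) p≗q = cong₂ ℕ._+_ (cong bit (p≗q x (here refl))) (count-cong p q xs (λ y y∈ → p≗q y (there y∈)))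

  count-complement : ∀ p xs → count (not ∘ p) xs ℕ.+ count p xs ≡ length xs
  count-complement p []       = refl
  count-complement p (x ∷ xs) with p x
  ... | true  = trans (ℕₚ.+-suc _ _) (cong suc (count-complement p xs))
  ... | false = cong suc (count-complement p xs)

  count-concat-≤ : ∀ p {B bs} → B ∈ bs → count p B ℕ.≤ count p (concat bs)
  count-concat-≤ p {B} {C ∷ cs} (here refl) = subst (count p B ℕ.≤_) (sym (count-++ p B (concat cs))) (ℕₚ.m≤m+n _ _)
  count-concat-≤ p {B} {C ∷ cs} (there B∈) = subst (count p B ℕ.≤_) (sym (count-++ p C (concat cs)))
                                                (ℕₚ.≤-trans (count-concat-≤ p B∈) (ℕₚ.m≤n+m _ _))

  occurrences : ℤ → List ℤ → ℕ
  occurrences x = count (λ y → does (y ≟ x))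

  occurrences-∈ : ∀ {x xs} → x ∈ xs → 1 ℕ.≤ occurrences x xs
  occurrences-∈ {x} (here refl) with x ≟ x
  ... | yes _  = ℕ.s≤s ℕ.z≤n
  ... | no x≢x = ⊥-elim (x≢x refl)
  occurrences-∈ {x} {y ∷ xs} (there x∈) = ℕₚ.≤-trans (occurrences-∈ x∈) (ℕₚ.m≤n+m _ (bit (does (y ≟ x))))

  occurrences-∉ : ∀ {x xs} → x ∉ xs → occurrences x xs ≡ 0
  occurrences-∉ {x} {[]}     _   = refl
  occurrences-∉ {x} {y ∷ ys} x∉ with y ≟ x
  ... | yes refl = ⊥-elim (x∉ (here refl))
  ... | no _     = occurrences-∉ (x∉ ∘ there)

  Increasing : List ℤ → Set
  Increasing = AllPairs _<_

  increasing-occurrences : ∀ {L} → Increasing L → ∀ x → occurrences x L ℕ.≤ 1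
  increasing-occurrences []           x = ℕ.z≤n
  increasing-occurrences {y ∷ ys} (y< ∷ inc) x with y ≟ x
  ... | yes refl = ℕ.s≤s (ℕₚ.≤-reflexive (occurrences-∉ λ y∈ → <-irrefl refl (All.lookup y< y∈)))
  ... | no _     = increasing-occurrences inc x

  module _ {_≺_ : Rel ℤ 0ℓ} (≺-order : IsStrictTotalOrder _≡_ _≺_) where
    open IsStrictTotalOrder ≺-order using (irrefl) renaming (_<?_ to _≺?_; trans to ≺-trans)

    first-above : ∀ x B → (∀ z → z ∈ B → ¬ x ≺ z)
                        ⊎ ∃[ m ] (m ∈ B × x ≺ m × (∀ z → z ∈ B → x ≺ z → ¬ z ≺ m))
    first-above x []      = inj₁ λ _ ()
    first-above x (b ∷ B) with first-above x B | x ≺? b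
    ... | inj₁ none | no ¬x≺b = inj₁ λ { z (here refl) → ¬x≺b ; z (there z∈) → none z z∈ }
    ... | inj₁ none | yes x≺b =
          inj₂ (b , here refl , x≺b , λ { z (here refl) _ → irrefl refl ; z (there z∈) x≺z → ⊥-elim (none z z∈ x≺z) })
    ... | inj₂ (m , m∈ , x≺m , first) | no ¬x≺b =
          inj₂ (m , there m∈ , x≺m , λ { z (here refl) x≺b → ⊥-elim (¬x≺b x≺b) ; z (there z∈) → first z z∈ })
    ... | inj₂ (m , m∈ , x≺m , first) | yes x≺b with b ≺? m
    ...   | yes b≺m = inj₂ (b , here refl , x≺b , λ { z (here refl) _ → irrefl refl
                                                    ; z (there z∈) x≺z z≺b → first z z∈ x≺z (≺-trans z≺b b≺m) })
    ...   | no ¬b≺m = inj₂ (m , there m∈ , x≺m , λ { z (here refl) _ → ¬b≺m ; z (there z∈) → first z z∈ })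

  -- Raw lists of blocks: the notions of Defs, stated for an arbitrary list of blocks so that
  -- they also apply to the block lists assembled during the construction of Λ⁺.
  -- For a partition Λ they unfold definitionally to SameBlock Λ, Arc Λ, MaxInBlock Λ, MinInBlock Λ.

  SameBlockIn : List (List ℤ) → ℤ → ℤ → Set
  SameBlockIn bs i j = ∃[ B ] (B ∈ bs × i ∈ B × j ∈ B)

  ArcIn : List (List ℤ) → ℤ → ℤ → Set
  ArcIn bs i j = i < j × (∃[ B ] (B ∈ bs × i ∈ B × j ∈ B × (∀ m → m ∈ B → i < m → j ≤ m)))

  MaxIn : List (List ℤ) → ℤ → Set
  MaxIn bs i = ∀ m → SameBlockIn bs i m → m ≤ i

  MinIn : List (List ℤ) → ℤ → Set
  MinIn bs i = ∀ m → SameBlockIn bs i m → i ≤ m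

  DuplicateFree : List (List ℤ) → Set
  DuplicateFree bs = ∀ x → occurrences x (concat bs) ℕ.≤ 1

  data Chain (bs : List (List ℤ)) : ℤ → ℤ → Set where
    []  : ∀ {i} → Chain bs i i
    _∷_ : ∀ {i k j} → ArcIn bs i k → Chain bs k j → Chain bs i j

  occurs-twice : ∀ {x} C cs → x ∈ C → x ∈ concat cs → 2 ℕ.≤ occurrences x (C ++ concat cs)
  occurs-twice C cs x∈C x∈cs =
    subst (2 ℕ.≤_) (sym (count-++ _ C (concat cs))) (ℕₚ.+-mono-≤ (occurrences-∈ x∈C) (occurrences-∈ x∈cs))

  twice≰once : ∀ {m} → 2 ℕ.≤ m → m ℕ.≤ 1 → ⊥
  twice≰once (ℕ.s≤s (ℕ.s≤s _)) (ℕ.s≤s ())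

  block-unique : ∀ {x B B′} bs → occurrences x (concat bs) ℕ.≤ 1 → x ∈ B → B ∈ bs → x ∈ B′ → B′ ∈ bs → B ≡ B′
  block-unique (C ∷ cs) _    _   (here refl) _    (here refl)  = refl
  block-unique (C ∷ cs) once x∈B (here refl) x∈B′ (there B′∈) = ⊥-elim (twice≰once (occurs-twice C cs x∈B (∈-concat⁺′ x∈B′ B′∈)) once)
  block-unique (C ∷ cs) once x∈B (there B∈)  x∈B′ (here refl)  = ⊥-elim (twice≰once (occurs-twice C cs x∈B′ (∈-concat⁺′ x∈B B∈)) once)
  block-unique {x} (C ∷ cs) once x∈B (there B∈) x∈B′ (there B′∈) = block-unique cs once-in-tail x∈B B∈ x∈B′ B′∈
    where
    once-in-tail : occurrences x (concat cs) ℕ.≤ 1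
    once-in-tail = ℕₚ.≤-trans (subst (occurrences x (concat cs) ℕ.≤_) (sym (count-++ _ C (concat cs))) (ℕₚ.m≤n+m _ _)) once

  distance-decreases : ∀ {i k j} → i < k → k ≤ j → ∣ j - k ∣ ℕ.< ∣ j - i ∣
  distance-decreases {i} {k} {j} i<k k≤j with j - k | i≤j⇒0≤j-i k≤j | +-monoʳ-< j (neg-mono-< i<k)
  ... | .(+ a) | +≤+ {n = a} _ | j-k<j-i with j - i | j-k<j-i
  ... | .(+ b) | +<+ {n = b} a<b = a<b

  module Blocks (bs : List (List ℤ)) (dup-free : DuplicateFree bs) where

    in-block : ∀ {i m B} → SameBlockIn bs i m → i ∈ B → B ∈ bs → m ∈ B
    in-block {i} (B′ , B′∈ , i∈B′ , m∈B′) i∈B B∈ = subst (_ ∈_) (block-unique bs (dup-free i) i∈B′ B′∈ i∈B B∈) m∈B′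

    same-sym : ∀ {i j} → SameBlockIn bs i j → SameBlockIn bs j i
    same-sym (B , B∈ , i∈ , j∈) = B , B∈ , j∈ , i∈

    same-trans : ∀ {i j k} → SameBlockIn bs i j → SameBlockIn bs j k → SameBlockIn bs i k
    same-trans (B , B∈ , i∈ , j∈) j~k = B , B∈ , i∈ , in-block j~k j∈ B∈

    same-reflˡ : ∀ {i j} → SameBlockIn bs i j → SameBlockIn bs i i
    same-reflˡ (B , B∈ , i∈ , _) = B , B∈ , i∈ , i∈

    arc-same : ∀ {i j} → ArcIn bs i j → SameBlockIn bs i j
    arc-same (_ , B , B∈ , i∈ , j∈ , _) = B , B∈ , i∈ , j∈

    arc-least : ∀ {i j m} → ArcIn bs i j → SameBlockIn bs i m → i < m → j ≤ m
    arc-least (_ , B , B∈ , i∈ , _ , least) i~m i<m = least _ (in-block i~m i∈ B∈) i<m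

    arc-intro : ∀ {i j} → i < j → SameBlockIn bs i j → (∀ m → SameBlockIn bs i m → i < m → j ≤ m) → ArcIn bs i j
    arc-intro i<j (B , B∈ , i∈ , j∈) least = i<j , B , B∈ , i∈ , j∈ , λ m m∈ → least m (B , B∈ , i∈ , m∈)

    arc-target-unique : ∀ {i j j′} → ArcIn bs i j → ArcIn bs i j′ → j ≡ j′
    arc-target-unique a a′ = ≤-antisym (arc-least a (arc-same a′) (proj₁ a′)) (arc-least a′ (arc-same a) (proj₁ a))

    arc-source-unique : ∀ {i i′ j} → ArcIn bs i j → ArcIn bs i′ j → i ≡ i′
    arc-source-unique {i} {i′} a a′ with <-cmp i i′
    ... | tri≈ _ i≡i′ _ = i≡i′
    ... | tri< i<i′ _ _ = ⊥-elim (<⇒≱ (proj₁ a′) (arc-least a (same-trans (arc-same a) (same-sym (arc-same a′))) i<i′))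
    ... | tri> _ _ i′<i = ⊥-elim (<⇒≱ (proj₁ a) (arc-least a′ (same-trans (arc-same a′) (same-sym (arc-same a))) i′<i))

    arc⇒¬max : ∀ {i j} → ArcIn bs i j → ¬ MaxIn bs i
    arc⇒¬max a max = <⇒≱ (proj₁ a) (max _ (arc-same a))

    arc⇒¬min : ∀ {i j} → ArcIn bs i j → ¬ MinIn bs j
    arc⇒¬min a min = <⇒≱ (proj₁ a) (min _ (same-sym (arc-same a)))

    max-or-arc : ∀ {i} → SameBlockIn bs i i → MaxIn bs i ⊎ ∃[ j ] ArcIn bs i j
    max-or-arc {i} (B , B∈ , i∈ , _) with first-above <-isStrictTotalOrder i B
    ... | inj₁ none = inj₁ λ m i~m → ≮⇒≥ (none m (in-block i~m i∈ B∈))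
    ... | inj₂ (j , j∈ , i<j , first) = inj₂ (j , i<j , B , B∈ , i∈ , j∈ , λ m m∈ i<m → ≮⇒≥ (first m m∈ i<m))

    min-or-arc : ∀ {j} → SameBlockIn bs j j → MinIn bs j ⊎ ∃[ i ] ArcIn bs i j
    min-or-arc {j} (B , B∈ , j∈ , _) with first-above (Flip.isStrictTotalOrder <-isStrictTotalOrder) j B
    ... | inj₁ none = inj₁ λ m j~m → ≮⇒≥ (none m (in-block j~m j∈ B∈))
    ... | inj₂ (i , i∈ , i<j , last) = inj₂ (i , i<j , B , B∈ , i∈ , j∈ , λ m m∈ i<m → ≮⇒≥ λ m<j → last m m∈ m<j i<m)

    -- Follow arcs from i until reaching j; the distance to j bounds the number of steps.
    chain-within : ∀ fuel {i j} → ∣ j - i ∣ ℕ.< fuel → SameBlockIn bs i j → i ≤ j → Chain bs i j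
    chain-within (suc fuel) {i} {j} bound i~j i≤j with i ≟ j
    ... | yes refl = []
    ... | no i≢j with max-or-arc (same-reflˡ i~j)
    ...   | inj₁ max = ⊥-elim (<⇒≱ (≤∧≢⇒< i≤j i≢j) (max j i~j))
    ...   | inj₂ (k , a) = a ∷ chain-within fuel (ℕₚ.<-≤-trans (distance-decreases (proj₁ a) k≤j) (ℕ.s≤s⁻¹ bound))
                                                    (same-trans (same-sym (arc-same a)) i~j) k≤j
      where
      k≤j : k ≤ j
      k≤j = arc-least a i~j (≤∧≢⇒< i≤j i≢j)

    chain : ∀ {i j} → SameBlockIn bs i j → i ≤ j → Chain bs i j
    chain = chain-within _ ℕₚ.≤-refl

    chain-crosses-zero : ∀ {u v B} → B ∈ bs → u ∈ B → Chain bs u v → u < 0ℤ → 0ℤ < v →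
                         + 0 ∈ B ⊎ ∃[ a ] ∃[ b ] (ArcIn bs a b × a < 0ℤ × 0ℤ < b × a ∈ B × b ∈ B)
    chain-crosses-zero B∈ u∈ [] u<0 0<u = ⊥-elim (<-asym u<0 0<u)
    chain-crosses-zero {u} B∈ u∈ (_∷_ {k = k} a c) u<0 0<v with k∈ ← in-block (arc-same a) u∈ B∈ | <-cmp k 0ℤ
    ... | tri< k<0 _ _  = chain-crosses-zero B∈ k∈ c k<0 0<v
    ... | tri≈ _ refl _ = inj₁ k∈
    ... | tri> _ _ 0<k  = inj₂ (u , k , a , u<0 , 0<k , u∈ , k∈)

    module _ (neg-element : ∀ {a} → SameBlockIn bs a a → SameBlockIn bs (- a) (- a))
             (neg-arc : ∀ {i j} → ArcIn bs i j → ArcIn bs (- j) (- i)) where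

      chain-negation : ∀ {a b} → SameBlockIn bs a a → Chain bs a b → SameBlockIn bs (- b) (- a)
      chain-negation a~a []      = neg-element a~a
      chain-negation _   (a ∷ c) = same-trans (chain-negation (same-reflˡ (same-sym (arc-same a))) c) (arc-same (neg-arc a))

      same-negation : ∀ {a b} → SameBlockIn bs a b → SameBlockIn bs (- a) (- b)
      same-negation {a} {b} a~b with ≤-total a b
      ... | inj₁ a≤b = same-sym (chain-negation (same-reflˡ a~b) (chain a~b a≤b))
      ... | inj₂ b≤a = chain-negation (same-reflˡ (same-sym a~b)) (chain (same-sym a~b) b≤a)

  -- For any decidable total order ≼, each nonempty block has exactly one ≼-greatest element;
  -- hence the number of blocks equals the number of elements greatest in their block.

  module BlockCount {_≼_ : Rel ℤ 0ℓ} (≼-order : IsDecTotalOrder _≡_ _≼_)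
                    (bs : List (List ℤ)) (dup-free : DuplicateFree bs) where
    open Blocks bs dup-free using (in-block)
    open IsDecTotalOrder ≼-order using (antisym; isTotalOrder) renaming (_≤?_ to _≼?_)

    ≼-totalOrder : TotalOrder 0ℓ 0ℓ 0ℓ
    ≼-totalOrder = record { isTotalOrder = isTotalOrder }

    open import Data.List.Extrema ≼-totalOrder using (max; ⊥≤max; xs≤max; argmax-all)

    Greatest : ℤ → Set
    Greatest x = ∀ m → SameBlockIn bs x m → m ≼ x

    greatest? : ∀ x → Dec (Greatest x)
    greatest? x with x ∈? concat bs
    ... | no x∉ = yes λ { m (B , B∈ , x∈B , _) → ⊥-elim (x∉ (∈-concat⁺′ x∈B B∈)) }
    ... | yes x∈ with ∈-concat⁻′ bs x∈
    ...   | B , x∈B , B∈ with All.all? (_≼? x) B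
    ...     | yes all≼x = yes λ m x~m → All.lookup all≼x (in-block x~m x∈B B∈)
    ...     | no ¬all≼x = no λ greatest → ¬all≼x (All.tabulate λ m∈ → greatest _ (B , B∈ , x∈B , m∈))

    is-greatest : ℤ → Bool
    is-greatest x = does (greatest? x)

    greatest-element : ∀ x xs → ∃[ e ] (e ∈ x ∷ xs × All (_≼ e) (x ∷ xs))
    greatest-element x xs = max x xs , argmax-all (λ y → y) (here refl) (All.tabulate there) , ⊥≤max x xs ∷ xs≤max x xs

    count-block : ∀ {B} → B ∈ bs → NonEmpty B → count is-greatest B ≡ 1
    count-block {[]}     _  (_ , ())
    count-block {x ∷ xs} B∈ _ with greatest-element x xs
    ... | e , e∈ , all≼e = trans (count-cong _ _ (x ∷ xs) greatest-is-e) (ℕₚ.≤-antisym at-most-once (occurrences-∈ e∈))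
      where
      at-most-once : occurrences e (x ∷ xs) ℕ.≤ 1
      at-most-once = ℕₚ.≤-trans (count-concat-≤ _ B∈) (dup-free e)
      greatest-is-e : ∀ z → z ∈ x ∷ xs → is-greatest z ≡ does (z ≟ e)
      greatest-is-e z z∈ with greatest? z | z ≟ e
      ... | yes _ | yes _ = refl
      ... | no _  | no _  = refl
      ... | yes greatest | no z≢e  = ⊥-elim (z≢e (antisym (All.lookup all≼e z∈) (greatest e (_ , B∈ , z∈ , e∈))))
      ... | no ¬greatest | yes refl = ⊥-elim (¬greatest λ m z~m → All.lookup all≼e (in-block z~m z∈ B∈))

    count-sublist : ∀ cs → (∀ {B} → B ∈ cs → B ∈ bs) → All NonEmpty cs → count is-greatest (concat cs) ≡ length cs
    count-sublist []       _  _            = refl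
    count-sublist (C ∷ cs) cs⊆ (ne ∷ nes) = trans (count-++ _ C (concat cs))
      (cong₂ ℕ._+_ (count-block (cs⊆ (here refl)) ne) (count-sublist cs (cs⊆ ∘ there) nes))

    count-blocks : ∀ {W} → concat bs ↭ W → All NonEmpty bs → count is-greatest W ≡ length bs
    count-blocks cover ne = trans (sym (count-↭ _ cover)) (count-sublist bs (λ B∈ → B∈) ne)

  add-to-block : ∀ {B₀} (bs : List (List ℤ)) → B₀ ∈ bs → ℤ → List (List ℤ)
  add-to-block (C ∷ cs) (here _)  x = (x ∷ C) ∷ cs
  add-to-block (C ∷ cs) (there p) x = C ∷ add-to-block cs p x

  add-to-block-covers : ∀ {B₀} bs (p : B₀ ∈ bs) x → concat (add-to-block bs p x) ↭ x ∷ concat bs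
  add-to-block-covers (C ∷ cs) (here _)  x = ↭-refl
  add-to-block-covers (C ∷ cs) (there p) x = ↭-trans (++⁺ˡ C (add-to-block-covers cs p x)) (shift x C (concat cs))

  add-to-block-nonempty : ∀ {B₀} bs (p : B₀ ∈ bs) x → All NonEmpty bs → All NonEmpty (add-to-block bs p x)
  add-to-block-nonempty (C ∷ cs) (here _)  x (_ ∷ ne)  = (x , here refl) ∷ ne
  add-to-block-nonempty (C ∷ cs) (there p) x (n ∷ ne) = n ∷ add-to-block-nonempty cs p x ne

  add-to-block-new : ∀ {B₀} bs (p : B₀ ∈ bs) x → (x ∷ B₀) ∈ add-to-block bs p x
  add-to-block-new (C ∷ cs) (here refl) x = here refl
  add-to-block-new (C ∷ cs) (there p)   x = there (add-to-block-new cs p x)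

  add-to-block⁻ : ∀ {B₀ B} bs (p : B₀ ∈ bs) x → B ∈ add-to-block bs p x → B ≡ x ∷ B₀ ⊎ B ∈ bs
  add-to-block⁻ (C ∷ cs) (here refl) x (here refl) = inj₁ refl
  add-to-block⁻ (C ∷ cs) (here refl) x (there B∈) = inj₂ (there B∈)
  add-to-block⁻ (C ∷ cs) (there p)   x (here refl) = inj₂ (here refl)
  add-to-block⁻ (C ∷ cs) (there p)   x (there B∈) with add-to-block⁻ cs p x B∈
  ... | inj₁ eq = inj₁ eq
  ... | inj₂ B∈cs = inj₂ (there B∈cs)

  add-to-block⁺ : ∀ {B₀ B} bs (p : B₀ ∈ bs) x → B ∈ bs → B ≡ B₀ ⊎ B ∈ add-to-block bs p x
  add-to-block⁺ (C ∷ cs) (here refl) x (here refl) = inj₁ refl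
  add-to-block⁺ (C ∷ cs) (here refl) x (there B∈) = inj₂ (there B∈)
  add-to-block⁺ (C ∷ cs) (there p)   x (here refl) = inj₂ (here refl)
  add-to-block⁺ (C ∷ cs) (there p)   x (there B∈) with add-to-block⁺ cs p x B∈
  ... | inj₁ eq = inj₁ eq
  ... | inj₂ B∈′ = inj₂ (there B∈′)

  -- The blocks
  -- are built from the largest element down: the next (smaller) element x joins the block of
  -- its R-successor if there is one, and otherwise starts a new block.

  module Realise (R : ℤ → ℤ → Set)
                 (R-increasing : ∀ {i j} → R i j → i < j)
                 (R-functional : ∀ {i j j′} → R i j → R i j′ → j ≡ j′)
                 (R-injective : ∀ {i i′ j} → R i j → R i′ j → i ≡ i′)
                 (R-successor? : ∀ i → (∃[ j ] R i j) ⊎ (∀ j → ¬ R i j)) where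

    record Realises (L : List ℤ) (bs : List (List ℤ)) : Set where
      field
        blocks-nonempty : All NonEmpty bs
        blocks-cover    : concat bs ↭ L
        arcs-sound      : ∀ {i j} → ArcIn bs i j → R i j × i ∈ L × j ∈ L
        arcs-complete   : ∀ {i j} → R i j → i ∈ L → j ∈ L → ArcIn bs i j

    module Join {x y : ℤ} {xs : List ℤ} {bs : List (List ℤ)}
                (x<xs : All (x <_) xs) (increasing : Increasing xs) (real : Realises xs bs)
                (xRy : R x y) (y∈xs : y ∈ xs) where
      open Realises real

      dup-free : DuplicateFree bs
      dup-free z = subst (ℕ._≤ 1) (sym (count-↭ _ blocks-cover)) (increasing-occurrences increasing z)

      open Blocks bs dup-free using (min-or-arc)

      y-block : ∃[ B₀ ] (y ∈ B₀ × B₀ ∈ bs)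
      y-block = ∈-concat⁻′ bs (∈-resp-↭ (↭-sym blocks-cover) y∈xs)

      B₀ : List ℤ
      B₀ = proj₁ y-block

      y∈B₀ : y ∈ B₀
      y∈B₀ = proj₁ (proj₂ y-block)

      B₀∈bs : B₀ ∈ bs
      B₀∈bs = proj₂ (proj₂ y-block)

      bs′ : List (List ℤ)
      bs′ = add-to-block bs B₀∈bs x

      in-xs : ∀ {z B} → z ∈ B → B ∈ bs → z ∈ xs
      in-xs z∈B B∈ = ∈-resp-↭ blocks-cover (∈-concat⁺′ z∈B B∈)

      x<elem : ∀ {z} → z ∈ xs → x < z
      x<elem = All.lookup x<xs

      -- y is least in its block: an arc (q , y) would be an R-pair, forcing q = x ∉ xs.
      y-least : ∀ m → m ∈ B₀ → y ≤ m
      y-least m m∈ with min-or-arc (B₀ , B₀∈bs , y∈B₀ , y∈B₀)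
      ... | inj₁ min = min m (B₀ , B₀∈bs , y∈B₀ , m∈)
      ... | inj₂ (q , arc) with arcs-sound arc
      ...   | qRy , q∈xs , _ with R-injective qRy xRy
      ...     | refl = ⊥-elim (<-irrefl refl (x<elem q∈xs))

      arc-x→y : ArcIn bs′ x y
      arc-x→y = R-increasing xRy , x ∷ B₀ , add-to-block-new bs B₀∈bs x , here refl , there y∈B₀ ,
                λ { m (here refl) x<x → ⊥-elim (<-irrefl refl x<x) ; m (there m∈) _ → y-least m m∈ }

      sound : ∀ {i j} → ArcIn bs′ i j → R i j × i ∈ x ∷ xs × j ∈ x ∷ xs
      sound (i<j , B , B∈ , i∈ , j∈ , least) with add-to-block⁻ bs B₀∈bs x B∈
      sound (i<j , B , B∈ , i∈ , j∈ , least) | inj₂ B∈bs with arcs-sound (i<j , B , B∈bs , i∈ , j∈ , least)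
      ... | iRj , i∈xs , j∈xs = iRj , there i∈xs , there j∈xs
      sound (i<j , _ , _ , here refl , here refl , _) | inj₁ refl = ⊥-elim (<-irrefl refl i<j)
      sound (i<j , _ , _ , here refl , there j∈ , least) | inj₁ refl =
        subst (R x) (≤-antisym (y-least _ j∈) (least y (there y∈B₀) (R-increasing xRy))) xRy , here refl , there (in-xs j∈ B₀∈bs)
      sound (i<j , _ , _ , there i∈ , here refl , _) | inj₁ refl = ⊥-elim (<⇒≱ i<j (<⇒≤ (x<elem (in-xs i∈ B₀∈bs))))
      sound (i<j , _ , _ , there i∈ , there j∈ , least) | inj₁ refl
        with arcs-sound (i<j , B₀ , B₀∈bs , i∈ , j∈ , λ m m∈ → least m (there m∈))
      ... | iRj , i∈xs , j∈xs = iRj , there i∈xs , there j∈xs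

      complete : ∀ {i j} → R i j → i ∈ x ∷ xs → j ∈ x ∷ xs → ArcIn bs′ i j
      complete iRj (here refl) _ = subst (ArcIn bs′ x) (R-functional xRy iRj) arc-x→y
      complete iRj (there i∈) (here refl) = ⊥-elim (<⇒≱ (R-increasing iRj) (<⇒≤ (x<elem i∈)))
      complete iRj (there i∈) (there j∈) with arcs-complete iRj i∈ j∈
      ... | i<j , B , B∈ , i∈B , j∈B , least with add-to-block⁺ bs B₀∈bs x B∈
      ...   | inj₂ B∈′ = i<j , B , B∈′ , i∈B , j∈B , least
      ...   | inj₁ refl = i<j , x ∷ B₀ , add-to-block-new bs B₀∈bs x , there i∈B , there j∈B ,
              λ { m (here refl) i<x → ⊥-elim (<⇒≱ i<x (<⇒≤ (x<elem i∈))) ; m (there m∈) → least m m∈ }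

      realises : Realises (x ∷ xs) bs′
      realises = record
        { blocks-nonempty = add-to-block-nonempty bs B₀∈bs x blocks-nonempty
        ; blocks-cover    = ↭-trans (add-to-block-covers bs B₀∈bs x) (prep x blocks-cover)
        ; arcs-sound      = sound
        ; arcs-complete   = complete
        }

    start-block : ∀ {x xs bs} → All (x <_) xs → Realises xs bs → (∀ j → j ∈ xs → ¬ R x j) → Realises (x ∷ xs) ([ x ] ∷ bs)
    start-block {x} {xs} {bs} x<xs real no-successor = record
      { blocks-nonempty = (x , here refl) ∷ blocks-nonempty
      ; blocks-cover    = prep x blocks-cover
      ; arcs-sound      = sound
      ; arcs-complete   = complete
      }
      where
      open Realises real
      sound : ∀ {i j} → ArcIn ([ x ] ∷ bs) i j → R i j × i ∈ x ∷ xs × j ∈ x ∷ xs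
      sound (i<j , _ , here refl , here refl , here refl , _) = ⊥-elim (<-irrefl refl i<j)
      sound (i<j , B , there B∈ , i∈ , j∈ , least) with arcs-sound (i<j , B , B∈ , i∈ , j∈ , least)
      ... | iRj , i∈xs , j∈xs = iRj , there i∈xs , there j∈xs
      complete : ∀ {i j} → R i j → i ∈ x ∷ xs → j ∈ x ∷ xs → ArcIn ([ x ] ∷ bs) i j
      complete iRj (here refl) (here refl) = ⊥-elim (<-irrefl refl (R-increasing iRj))
      complete iRj (here refl) (there j∈)  = ⊥-elim (no-successor _ j∈ iRj)
      complete iRj (there i∈)  (here refl) = ⊥-elim (<⇒≱ (R-increasing iRj) (<⇒≤ (All.lookup x<xs i∈)))
      complete iRj (there i∈)  (there j∈) with arcs-complete iRj i∈ j∈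
      ... | i<j , B , B∈ , i∈B , j∈B , least = i<j , B , there B∈ , i∈B , j∈B , least

    realise : ∀ L → Increasing L → ∃[ bs ] Realises L bs
    realise [] [] = [] , record
      { blocks-nonempty = []
      ; blocks-cover    = ↭-refl
      ; arcs-sound      = λ { (_ , _ , () , _) }
      ; arcs-complete   = λ _ ()
      }
    realise (x ∷ xs) (x<xs ∷ increasing) with realise xs increasing | R-successor? x
    ... | bs , real | inj₂ none = [ x ] ∷ bs , start-block x<xs real (λ j _ → none j)
    ... | bs , real | inj₁ (y , xRy) with y ∈? xs
    ...   | yes y∈xs = _ , Join.realises x<xs increasing real xRy y∈xs
    ...   | no y∉xs  = [ x ] ∷ bs , start-block x<xs real (λ j j∈ xRj → y∉xs (subst (_∈ xs) (R-functional xRj xRy) j∈))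

  range : ℤ → ℕ → List ℤ
  range a zero    = []
  range a (suc k) = a ∷ range (a + 1ℤ) k

  range-step : ∀ a k → (a + 1ℤ) + + k ≡ a + + suc k
  range-step a k = +-assoc a 1ℤ (+ k)

  range-snoc : ∀ a k → range a (suc k) ≡ range a k ++ [ a + + k ]
  range-snoc a zero    = cong [_] (sym (+-identityʳ a))
  range-snoc a (suc k) = cong (a ∷_) (trans (range-snoc (a + 1ℤ) k) (cong (λ z → range (a + 1ℤ) k ++ [ z ]) (range-step a k)))

  range-bounds : ∀ {x} a k → x ∈ range a k → a ≤ x × x < a + + k
  range-bounds a (suc k) (here refl) = ≤-refl , subst (_< a + + suc k) (+-identityʳ a) (+-monoʳ-< a (+<+ (ℕ.s≤s ℕ.z≤n)))
  range-bounds {x} a (suc k) (there x∈) with range-bounds (a + 1ℤ) k x∈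
  ... | lower , upper = <⇒≤ (<-≤-trans (x<x+1 a) lower) , subst (x <_) (range-step a k) upper

  range-∋ : ∀ {x} a k → a ≤ x → x < a + + k → x ∈ range a k
  range-∋ {x} a zero    lower upper = ⊥-elim (<⇒≱ upper (subst (_≤ x) (sym (+-identityʳ a)) lower))
  range-∋ {x} a (suc k) lower upper with a ≟ x
  ... | yes refl = here refl
  ... | no a≢x   = there (range-∋ (a + 1ℤ) k (<⇒+1≤ (≤∧≢⇒< lower a≢x)) (subst (x <_) (sym (range-step a k)) upper))

  range-increasing : ∀ a k → Increasing (range a k)
  range-increasing a zero    = []
  range-increasing a (suc k) = All.tabulate (λ x∈ → <-≤-trans (x<x+1 a) (proj₁ (range-bounds (a + 1ℤ) k x∈)))
                               ∷ range-increasing (a + 1ℤ) k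

  count-shift : ∀ (g : ℤ → Bool) a k →
    bit (g a) ℕ.+ count (λ x → g (x + 1ℤ)) (range a k) ≡ count g (range a k) ℕ.+ bit (g (a + + k))
  count-shift g a zero    = trans (ℕₚ.+-identityʳ _) (cong (bit ∘ g) (sym (+-identityʳ a)))
  count-shift g a (suc k) = begin
    bit (g a) ℕ.+ (bit (g (a + 1ℤ)) ℕ.+ count (λ x → g (x + 1ℤ)) (range (a + 1ℤ) k))
      ≡⟨ cong (bit (g a) ℕ.+_) (count-shift g (a + 1ℤ) k) ⟩
    bit (g a) ℕ.+ (count g (range (a + 1ℤ) k) ℕ.+ bit (g ((a + 1ℤ) + + k)))
      ≡⟨ ℕₚ.+-assoc (bit (g a)) _ _ ⟨
    count g (range a (suc k)) ℕ.+ bit (g ((a + 1ℤ) + + k))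
      ≡⟨ cong (λ z → count g (range a (suc k)) ℕ.+ bit (g z)) (range-step a k) ⟩
    count g (range a (suc k)) ℕ.+ bit (g (a + + suc k))
      ∎
    where open ≡-Reasoning

  interval : ℕ → List ℤ
  interval n = range (- (+ n)) (suc (n ℕ.+ n))

  interval-end : ∀ n → - (+ n) + + suc (n ℕ.+ n) ≡ + suc n
  interval-end n = cancel (+ suc n) (+ n)
    where
    cancel : ∀ a b → - b + (a + b) ≡ a
    cancel = solve-∀

  interval-unfold : ∀ n → interval (suc n) ≡ - (+ suc n) ∷ (interval n ++ [ + suc n ])
  interval-unfold n = cong (- (+ suc n) ∷_) (begin
    range (-[1+n] + 1ℤ) (suc (n ℕ.+ suc n))    ≡⟨ cong₂ range (trans (+-comm -[1+n] 1ℤ) (1-[1+n]≡-n n)) (cong suc (ℕₚ.+-suc n n)) ⟩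
    range (- (+ n)) (suc (suc (n ℕ.+ n)))       ≡⟨ range-snoc (- (+ n)) (suc (n ℕ.+ n)) ⟩
    interval n ++ [ - (+ n) + + suc (n ℕ.+ n) ] ≡⟨ cong (λ z → interval n ++ [ z ]) (interval-end n) ⟩
    interval n ++ [ + suc n ]                   ∎)
    where
    open ≡-Reasoning
    -[1+n] : ℤ
    -[1+n] = - (+ suc n)

  interval↭elems : ∀ n → interval n ↭ elems n
  interval↭elems zero    = ↭-refl
  interval↭elems (suc n) = begin
    interval (suc n)                                   ≡⟨ interval-unfold n ⟩
    - (+ suc n) ∷ (interval n ++ [ + suc n ])          ↭⟨ prep _ (shift (+ suc n) (interval n) []) ⟩
    - (+ suc n) ∷ + suc n ∷ (interval n ++ [])         ≡⟨ cong (λ l → - (+ suc n) ∷ + suc n ∷ l) (++-identityʳ (interval n)) ⟩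
    - (+ suc n) ∷ + suc n ∷ interval n                 ↭⟨ swap _ _ (interval↭elems n) ⟩
    elems (suc n)                                      ∎
    where open PermutationReasoning

  elems-bounds : ∀ {n x} → x ∈ elems n → - (+ n) ≤ x × x ≤ + n
  elems-bounds {n} x∈ with range-bounds (- (+ n)) (suc (n ℕ.+ n)) (∈-resp-↭ (↭-sym (interval↭elems n)) x∈)
  ... | lower , upper = lower , ≮⇒≥ λ n<x → <⇒≱ (subst (_ <_) (interval-end n) upper) (i<j⇒suc[i]≤j n<x)

  elems-∋ : ∀ {n x} → - (+ n) ≤ x → x ≤ + n → x ∈ elems n
  elems-∋ {n} lower upper = ∈-resp-↭ (interval↭elems n)
    (range-∋ (- (+ n)) (suc (n ℕ.+ n)) lower (subst (_ <_) (sym (interval-end n)) (≤-<-trans upper (+<+ (ℕₚ.n<1+n _)))))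

  elems-occurrences : ∀ n x → occurrences x (elems n) ℕ.≤ 1
  elems-occurrences n x = subst (ℕ._≤ 1) (count-↭ _ (interval↭elems n)) (increasing-occurrences (range-increasing (- (+ n)) (suc (n ℕ.+ n))) x)

  elems-neg : ∀ {n x} → x ∈ elems n → - x ∈ elems n
  elems-neg {n} {x} x∈ with elems-bounds x∈
  ... | lower , upper = elems-∋ (neg-mono-≤ upper) (subst (- x ≤_) (neg-involutive (+ n)) (neg-mono-≤ lower))

  elems-length : ∀ n → length (elems n) ≡ suc (n ℕ.+ n)
  elems-length zero    = refl
  elems-length (suc n) = cong (suc ∘ suc) (trans (elems-length n) (sym (ℕₚ.+-suc n n)))

  count-shift-elems : ∀ (g : ℤ → Bool) n →
    bit (g (- (+ n))) ℕ.+ count (λ x → g (x + 1ℤ)) (elems n) ≡ count g (elems n) ℕ.+ bit (g (+ suc n))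
  count-shift-elems g n = begin
    bit (g (- (+ n))) ℕ.+ count (λ x → g (x + 1ℤ)) (elems n)  ≡⟨ cong (bit (g (- (+ n))) ℕ.+_) (count-↭ _ (↭-sym (interval↭elems n))) ⟩
    bit (g (- (+ n))) ℕ.+ count (λ x → g (x + 1ℤ)) (interval n) ≡⟨ count-shift g (- (+ n)) (suc (n ℕ.+ n)) ⟩
    count g (interval n) ℕ.+ bit (g (- (+ n) + + suc (n ℕ.+ n))) ≡⟨ cong₂ (λ c z → c ℕ.+ bit (g z)) (count-↭ g (interval↭elems n)) (interval-end n) ⟩
    count g (elems n) ℕ.+ bit (g (+ suc n))                    ∎
    where open ≡-Reasoning

  neg-∈ : ∀ {x B} → x ∈ B → - x ∈ negList B
  neg-∈ (here refl) = here refl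
  neg-∈ (there x∈)  = there (neg-∈ x∈)

  neg-∈⁻ : ∀ {y B} → y ∈ negList B → - y ∈ B
  neg-∈⁻ {B = b ∷ B} (here refl) = here (neg-involutive b)
  neg-∈⁻ {B = b ∷ B} (there y∈)  = there (neg-∈⁻ y∈)

  self-negating-closed : ∀ {B} → SameSet B (negList B) → ∀ {y} → y ∈ B → - y ∈ B
  self-negating-closed B≈-B y∈ = neg-∈⁻ (proj₁ (B≈-B _) y∈)

  partition-dup-free : ∀ {n} (Λ : Partition n) → DuplicateFree (blocks Λ)
  partition-dup-free {n} Λ x = subst (ℕ._≤ 1) (sym (count-↭ _ (covers Λ))) (elems-occurrences n x)

  module Partitioned {n} (Λ : Partition n) where
    open Blocks (blocks Λ) (partition-dup-free Λ) public

    same⇒elem : ∀ {a b} → SameBlock Λ a b → a ∈ elems n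
    same⇒elem (B , B∈ , a∈ , _) = ∈-resp-↭ (covers Λ) (∈-concat⁺′ a∈ B∈)

    elem⇒same : ∀ {a} → a ∈ elems n → SameBlock Λ a a
    elem⇒same a∈ with ∈-concat⁻′ (blocks Λ) (∈-resp-↭ (↭-sym (covers Λ)) a∈)
    ... | B , a∈B , B∈ = B , B∈ , a∈B , a∈B

    module ByMaxima = BlockCount ≤-isDecTotalOrder (blocks Λ) (partition-dup-free Λ)
    module ByMinima = BlockCount (Flip.isDecTotalOrder ≤-isDecTotalOrder) (blocks Λ) (partition-dup-free Λ)

  module Symmetric {n} (Λ : Partition n) (symmetric : InPiB Λ) where
    open Partitioned Λ public

    same-neg : ∀ {a b} → SameBlock Λ a b → SameBlock Λ (- a) (- b)
    same-neg (B , B∈ , a∈ , b∈) with proj₁ symmetric B B∈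
    ... | B′ , B′∈ , B′≈-B = B′ , B′∈ , proj₂ (B′≈-B _) (neg-∈ a∈) , proj₂ (B′≈-B _) (neg-∈ b∈)

    same-neg′ : ∀ {a b} → SameBlock Λ (- a) b → SameBlock Λ a (- b)
    same-neg′ {a} s = subst (λ z → SameBlock Λ z _) (neg-involutive a) (same-neg s)

    arc-neg : ∀ {i j} → Arc Λ i j → Arc Λ (- j) (- i)
    arc-neg {i} {j} a = arc-intro (neg-mono-< (proj₁ a)) (same-neg (same-sym (arc-same a))) least
      where
      least : ∀ m → SameBlock Λ (- j) m → - j < m → - i ≤ m
      least m -j~m -j<m = ≮⇒≥ λ m<-i → <⇒≱ (subst (_ <_) (neg-involutive j) (neg-mono-< -j<m))
        (arc-least a (same-trans (arc-same a) (same-neg′ -j~m)) (subst (_< - m) (neg-involutive i) (neg-mono-< m<-i)))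

    max-neg : ∀ {i} → MaxInBlock Λ i → MinInBlock Λ (- i)
    max-neg {i} max m -i~m = subst (- i ≤_) (neg-involutive m) (neg-mono-≤ (max (- m) (same-neg′ -i~m)))

    min-neg : ∀ {i} → MinInBlock Λ i → MaxInBlock Λ (- i)
    min-neg {i} min m -i~m = subst (_≤ - i) (neg-involutive m) (neg-mono-≤ (min (- m) (same-neg′ -i~m)))

    self-neg-zero : ∀ {a} → SameBlock Λ a (- a) → SameBlock Λ a (+ 0)
    self-neg-zero {a} (B , B∈ , a∈ , -a∈) with proj₁ symmetric B B∈
    ... | B′ , B′∈ , B′≈-B with block-unique (blocks Λ) (partition-dup-free Λ (- a)) -a∈ B∈ (proj₂ (B′≈-B _) (neg-∈ a∈)) B′∈
    ... | refl = B , B∈ , a∈ , proj₂ symmetric B B∈ B′≈-B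

  module PlusArcs {n} (Λ : Partition n) (nc : InNCB Λ) where
    open Symmetric Λ (proj₁ nc) public

    plus-increasing : ∀ {i j} → PlusArc Λ i j → i < j
    plus-increasing (inj₁ (a , _))      = proj₁ a
    plus-increasing {i} (inj₂ (refl , _)) = x<x+1 i

    plus-elems : ∀ {i j} → PlusArc Λ i j → i ∈ elems n × j ∈ elems n
    plus-elems (inj₁ (a , _))             = same⇒elem (arc-same a) , same⇒elem (same-sym (arc-same a))
    plus-elems (inj₂ (_ , i∈ , j∈ , _))   = i∈ , j∈

    plus-functional : ∀ {i j j′} → PlusArc Λ i j → PlusArc Λ i j′ → j ≡ j′
    plus-functional (inj₁ (a , _)) (inj₁ (a′ , _))           = arc-target-unique a a′
    plus-functional (inj₁ (a , _)) (inj₂ (_ , _ , _ , max , _)) = ⊥-elim (arc⇒¬max a max)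
    plus-functional (inj₂ (_ , _ , _ , max , _)) (inj₁ (a , _)) = ⊥-elim (arc⇒¬max a max)
    plus-functional (inj₂ (refl , _)) (inj₂ (refl , _))       = refl

    plus-injective : ∀ {i i′ j} → PlusArc Λ i j → PlusArc Λ i′ j → i ≡ i′
    plus-injective (inj₁ (a , _)) (inj₁ (a′ , _))               = arc-source-unique a a′
    plus-injective (inj₁ (a , _)) (inj₂ (_ , _ , _ , _ , min))  = ⊥-elim (arc⇒¬min a min)
    plus-injective (inj₂ (_ , _ , _ , _ , min)) (inj₁ (a , _))  = ⊥-elim (arc⇒¬min a min)
    plus-injective (inj₂ (j≡i+1 , _)) (inj₂ (j≡i′+1 , _))       = +1-injective (trans (sym j≡i+1) j≡i′+1)

    plus-successor? : ∀ i → (∃[ j ] PlusArc Λ i j) ⊎ (∀ j → ¬ PlusArc Λ i j)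
    plus-successor? i with i ∈? elems n
    ... | no i∉ = inj₂ λ j r → i∉ (proj₁ (plus-elems r))
    ... | yes i∈ with max-or-arc (elem⇒same i∈)
    ...   | inj₂ (j , a) with j ≟ i + 1ℤ
    ...     | no j≢i+1 = inj₁ (j , inj₁ (a , j≢i+1))
    ...     | yes refl = inj₂ λ { j′ (inj₁ (a′ , j′≢i+1)) → j′≢i+1 (sym (arc-target-unique a a′))
                                ; j′ (inj₂ (_ , _ , _ , max , _)) → arc⇒¬max a max }
    plus-successor? i | yes i∈ | inj₁ max with (i + 1ℤ) ∈? elems n
    ...   | no i+1∉ = inj₂ λ { j′ (inj₁ (a′ , _)) → arc⇒¬max a′ max ; j′ (inj₂ (refl , _ , j∈ , _)) → i+1∉ j∈ }
    ...   | yes i+1∈ with min-or-arc (elem⇒same i+1∈)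
    ...     | inj₁ min = inj₁ (i + 1ℤ , inj₂ (refl , i∈ , i+1∈ , max , min))
    ...     | inj₂ (_ , a) = inj₂ λ { j′ (inj₁ (a′ , _)) → arc⇒¬max a′ max ; j′ (inj₂ (refl , _ , _ , _ , min)) → arc⇒¬min a min }

    plus-neg : ∀ {i j} → PlusArc Λ i j → PlusArc Λ (- j) (- i)
    plus-neg (inj₁ (a , j≢i+1))                = inj₁ (arc-neg a , λ eq → j≢i+1 (neg-step⁻ eq))
    plus-neg (inj₂ (eq , i∈ , j∈ , max , min)) = inj₂ (neg-step eq , elems-neg j∈ , elems-neg i∈ , min-neg min , max-neg max)

    open Realise (PlusArc Λ) plus-increasing plus-functional plus-injective plus-successor?

    plus-exists : ∃[ Λ⁺ ] IsPlus Λ Λ⁺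
    plus-exists with realise (interval n) (range-increasing (- (+ n)) (suc (n ℕ.+ n)))
    ... | bs , real = mkPartition bs blocks-nonempty (↭-trans blocks-cover (interval↭elems n)) ,
                      λ i j → (λ a → proj₁ (arcs-sound a)) , λ r → arcs-complete r (in-interval (proj₁ (plus-elems r))) (in-interval (proj₂ (plus-elems r)))
      where
      open Realises real
      in-interval : ∀ {x} → x ∈ elems n → x ∈ interval n
      in-interval = ∈-resp-↭ (↭-sym (interval↭elems n))

  module PlusPartition {n} (Λ : Partition n) (nc : InNCB Λ) (Λ⁺ : Partition n) (plus : IsPlus Λ Λ⁺) where
    open PlusArcs Λ nc
    module P = Partitioned Λ⁺

    to-plus : ∀ {i j} → Arc Λ⁺ i j → PlusArc Λ i j
    to-plus {i} {j} = proj₁ (plus i j)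

    from-plus : ∀ {i j} → PlusArc Λ i j → Arc Λ⁺ i j
    from-plus {i} {j} = proj₂ (plus i j)

    -- Arcs of T join neighbours and so cross nothing; the others are arcs of Λ.
    noncrossing⁺ : ∀ i j k l → Arc Λ⁺ i k → Arc Λ⁺ j l → i < j → j < k → k < l → i ≡ - l × k ≡ - j
    noncrossing⁺ i j k l ik jl i<j j<k k<l with to-plus ik | to-plus jl
    ... | inj₂ (refl , _) | _                 = ⊥-elim (nothing-between i<j j<k)
    ... | inj₁ _          | inj₂ (refl , _)   = ⊥-elim (nothing-between j<k k<l)
    ... | inj₁ (ik′ , _)  | inj₁ (jl′ , _)    = proj₂ nc i j k l ik′ jl′ i<j j<k k<l

    arc-neg⁺ : ∀ {i j} → Arc Λ⁺ i j → Arc Λ⁺ (- j) (- i)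
    arc-neg⁺ = from-plus ∘ plus-neg ∘ to-plus

    -- Λ⁺ inherits the symmetry of Λ: negation maps its arcs to arcs, hence its blocks to blocks.
    same-neg⁺ : ∀ {a b} → SameBlock Λ⁺ a b → SameBlock Λ⁺ (- a) (- b)
    same-neg⁺ = P.same-negation (P.elem⇒same ∘ elems-neg ∘ P.same⇒elem) arc-neg⁺

    same-neg⁺′ : ∀ {a b} → SameBlock Λ⁺ a (- b) → SameBlock Λ⁺ (- a) b
    same-neg⁺′ {a} {b} s = subst (SameBlock Λ⁺ (- a)) (neg-involutive b) (same-neg⁺ s)

    neg-block⁺ : ∀ B → B ∈ blocks Λ⁺ → ∃[ B′ ] (B′ ∈ blocks Λ⁺ × SameSet B′ (negList B))
    neg-block⁺ B B∈ with All.lookup (nonempty Λ⁺) B∈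
    ... | x , x∈ with P.elem⇒same (elems-neg (P.same⇒elem (B , B∈ , x∈ , x∈)))
    ... | B′ , B′∈ , -x∈ , _ = B′ , B′∈ , λ y →
            (λ y∈ → subst (_∈ negList B) (neg-involutive y) (neg-∈ (P.in-block (x~-y y∈) x∈ B∈)))
          , (λ y∈ → P.in-block (same-neg⁺′ (B , B∈ , x∈ , neg-∈⁻ y∈)) -x∈ B′∈)
      where
      x~-y : ∀ {y} → y ∈ B′ → SameBlock Λ⁺ x (- y)
      x~-y y∈ = subst (λ z → SameBlock Λ⁺ z _) (neg-involutive x) (same-neg⁺ (B′ , B′∈ , -x∈ , y∈))

    -- No arc of Λ⁺ jumps over 0 inside a self-negating block B: its mirror image, or the
    -- zero block of Λ, would supply an element of B strictly inside the arc.
    no-arc-over-zero : ∀ {B a b} → B ∈ blocks Λ⁺ → (∀ {y} → y ∈ B → - y ∈ B) →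
                       Arc Λ⁺ a b → a < 0ℤ → 0ℤ < b → a ∈ B → b ∈ B → ⊥
    no-arc-over-zero {B} {a} {b} B∈ neg-closed ab a<0 0<b a∈ b∈ with to-plus ab
    ... | inj₂ (refl , _) = nothing-between a<0 0<b
    ... | inj₁ (abΛ , _) with <-cmp a (- b)
    ...   | tri< a<-b _ _  = <⇒≱ (<-trans (neg-mono-< 0<b) 0<b) (P.arc-least ab (B , B∈ , a∈ , neg-closed b∈) a<-b)
    ...   | tri> _ _ -b<a  = <⇒≱ (<-trans a<0 (neg-mono-< a<0)) (P.arc-least (arc-neg⁺ ab) (B , B∈ , neg-closed b∈ , a∈) -b<a)
    ...   | tri≈ _ refl _  = <⇒≱ 0<b (arc-least abΛ (self-neg-zero (subst (SameBlock Λ (- b)) (sym (neg-involutive b)) (arc-same abΛ)))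
                                                  (neg-mono-< 0<b))

    zero-between : ∀ {B u v} → B ∈ blocks Λ⁺ → (∀ {y} → y ∈ B → - y ∈ B) → u ∈ B → v ∈ B → u < 0ℤ → 0ℤ < v → + 0 ∈ B
    zero-between B∈ neg-closed u∈ v∈ u<0 0<v
      with P.chain-crosses-zero B∈ u∈ (P.chain (_ , B∈ , u∈ , v∈) (<⇒≤ (<-trans u<0 0<v))) u<0 0<v
    ... | inj₁ 0∈ = 0∈
    ... | inj₂ (a , b , ab , a<0 , 0<b , a∈ , b∈) = ⊥-elim (no-arc-over-zero B∈ neg-closed ab a<0 0<b a∈ b∈)

    -- A self-negating block of Λ⁺ contains some x and -x, hence (by the above) 0.
    zero-block⁺ : ∀ B → B ∈ blocks Λ⁺ → SameSet B (negList B) → + 0 ∈ B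
    zero-block⁺ B B∈ B≈-B with All.lookup (nonempty Λ⁺) B∈
    ... | x , x∈ with <-cmp x 0ℤ
    ...   | tri≈ _ refl _ = x∈
    ...   | tri< x<0 _ _  = zero-between B∈ (self-negating-closed B≈-B) x∈ (self-negating-closed B≈-B x∈) x<0 (neg-mono-< x<0)
    ...   | tri> _ _ 0<x  = zero-between B∈ (self-negating-closed B≈-B) (self-negating-closed B≈-B x∈) x∈ (neg-mono-< 0<x) 0<x

    symmetric⁺ : InPiB Λ⁺
    symmetric⁺ = neg-block⁺ , zero-block⁺

    -- After a long arc (i , j) of Λ, i + 1 is a minimum: an arc (h , i + 1) with h < i would
    -- cross (i , j), forcing i + 1 = -i.
    long-arc-next-min : ∀ {i j} → Arc Λ i j → j ≢ i + 1ℤ → (i + 1ℤ) ∈ elems n × MinInBlock Λ (i + 1ℤ)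
    long-arc-next-min {i} {j} ij j≢i+1 = i+1∈ , next-min
      where
      i+1<j : i + 1ℤ < j
      i+1<j = ≤∧≢⇒< (<⇒+1≤ (proj₁ ij)) (j≢i+1 ∘ sym)
      i+1∈ : (i + 1ℤ) ∈ elems n
      i+1∈ = elems-∋ (≤-trans (proj₁ (elems-bounds (same⇒elem (arc-same ij)))) (<⇒≤ (x<x+1 i)))
                     (≤-trans (<⇒≤ i+1<j) (proj₂ (elems-bounds (same⇒elem (same-sym (arc-same ij))))))
      next-min : MinInBlock Λ (i + 1ℤ)
      next-min with min-or-arc (elem⇒same i+1∈)
      ... | inj₁ min = min
      ... | inj₂ (h , hi) with h ≟ i
      ...   | yes refl = ⊥-elim (j≢i+1 (arc-target-unique ij hi))
      ...   | no h≢i   = ⊥-elim (x+1≢-x i (proj₂ (proj₂ nc h i (i + 1ℤ) j hi ij h<i (x<x+1 i) i+1<j)))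
        where
        h<i : h < i
        h<i = ≤∧≢⇒< (<+1⇒≤ (proj₁ hi)) h≢i

    max⁺⇒¬next-min : ∀ {x} → x ∈ elems n → MaxInBlock Λ⁺ x → (x + 1ℤ) ∈ elems n → ¬ MinInBlock Λ (x + 1ℤ)
    max⁺⇒¬next-min {x} x∈ max⁺ x+1∈ min with max-or-arc (elem⇒same x∈)
    ... | inj₁ max = P.arc⇒¬max (from-plus (inj₂ (refl , x∈ , x+1∈ , max , min))) max⁺
    ... | inj₂ (j , xj) with j ≟ x + 1ℤ
    ...   | yes refl   = arc⇒¬min xj min
    ...   | no j≢x+1   = P.arc⇒¬max (from-plus (inj₁ (xj , j≢x+1))) max⁺

    ¬next-min⇒max⁺ : ∀ {x} → x ∈ elems n → ¬ ((x + 1ℤ) ∈ elems n × MinInBlock Λ (x + 1ℤ)) → MaxInBlock Λ⁺ x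
    ¬next-min⇒max⁺ x∈ ¬next-min with P.max-or-arc (P.elem⇒same x∈)
    ... | inj₁ max⁺ = max⁺
    ... | inj₂ (j , xj) with to-plus xj
    ...   | inj₂ (refl , _ , j∈ , _ , min) = ⊥-elim (¬next-min (j∈ , min))
    ...   | inj₁ (xjΛ , j≢x+1)             = ⊥-elim (¬next-min (long-arc-next-min xjΛ j≢x+1))

    starts-block : ℤ → Bool
    starts-block y = does (y ∈? elems n) ∧ ByMinima.is-greatest y

    max⁺-test : ∀ x → x ∈ elems n → P.ByMaxima.is-greatest x ≡ not (starts-block (x + 1ℤ))
    max⁺-test x x∈ with P.ByMaxima.greatest? x | (x + 1ℤ) ∈? elems n | ByMinima.greatest? (x + 1ℤ)
    ... | yes max⁺ | yes x+1∈ | yes min  = ⊥-elim (max⁺⇒¬next-min x∈ max⁺ x+1∈ min)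
    ... | yes _    | yes _    | no _     = refl
    ... | yes _    | no _     | _        = refl
    ... | no _     | yes _    | yes _    = refl
    ... | no ¬max⁺ | yes _    | no ¬min  = ⊥-elim (¬max⁺ (¬next-min⇒max⁺ x∈ (¬min ∘ proj₂)))
    ... | no ¬max⁺ | no x+1∉  | _        = ⊥-elim (¬max⁺ (¬next-min⇒max⁺ x∈ (x+1∉ ∘ proj₁)))

    starts-block-test : ∀ y → y ∈ elems n → starts-block y ≡ ByMinima.is-greatest y
    starts-block-test y y∈ with y ∈? elems n
    ... | yes _  = refl
    ... | no y∉ = ⊥-elim (y∉ y∈)

    lowest-starts-block : starts-block (- (+ n)) ≡ true
    lowest-starts-block with - (+ n) ∈? elems n | ByMinima.greatest? (- (+ n))
    ... | yes _ | yes _ = refl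
    ... | yes _ | no ¬min = ⊥-elim (¬min λ m -n~m → proj₁ (elems-bounds (same⇒elem (same-sym -n~m))))
    ... | no -n∉ | _ = ⊥-elim (-n∉ (elems-∋ ≤-refl neg-≤-pos))

    beyond-starts-no-block : starts-block (+ suc n) ≡ false
    beyond-starts-no-block with + suc n ∈? elems n
    ... | no _ = refl
    ... | yes n+1∈ = ⊥-elim (<⇒≱ (+<+ (ℕₚ.n<1+n n)) (proj₂ (elems-bounds n+1∈)))

    block-count⁺ : #blocks Λ⁺ ℕ.+ #blocks Λ ≡ 2 ℕ.+ (n ℕ.+ n)
    block-count⁺ = begin
      #blocks Λ⁺ ℕ.+ #blocks Λ
        ≡⟨ cong₂ ℕ._+_ (sym count-max⁺) (sym count-starts) ⟩
      count (not ∘ next-starts) (elems n) ℕ.+ count starts-block (elems n)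
        ≡⟨ cong (count (not ∘ next-starts) (elems n) ℕ.+_) shifted ⟩
      count (not ∘ next-starts) (elems n) ℕ.+ suc (count next-starts (elems n))
        ≡⟨ ℕₚ.+-suc _ _ ⟩
      suc (count (not ∘ next-starts) (elems n) ℕ.+ count next-starts (elems n))
        ≡⟨ cong suc (trans (count-complement next-starts (elems n)) (elems-length n)) ⟩
      2 ℕ.+ (n ℕ.+ n)
        ∎
      where
      open ≡-Reasoning
      next-starts : ℤ → Bool
      next-starts x = starts-block (x + 1ℤ)
      count-max⁺ : count (not ∘ next-starts) (elems n) ≡ #blocks Λ⁺
      count-max⁺ = trans (sym (count-cong _ _ (elems n) max⁺-test)) (P.ByMaxima.count-blocks (covers Λ⁺) (nonempty Λ⁺))
      count-starts : count starts-block (elems n) ≡ #blocks Λ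
      count-starts = trans (count-cong _ _ (elems n) starts-block-test) (ByMinima.count-blocks (covers Λ) (nonempty Λ))
      -- all block starts but the first one, -n, are successors of elements of the ground set
      shifted : count starts-block (elems n) ≡ suc (count next-starts (elems n))
      shifted = begin
        count starts-block (elems n)                                  ≡⟨ ℕₚ.+-identityʳ _ ⟨
        count starts-block (elems n) ℕ.+ 0                            ≡⟨ cong (λ b → count starts-block (elems n) ℕ.+ bit b) beyond-starts-no-block ⟨
        count starts-block (elems n) ℕ.+ bit (starts-block (+ suc n)) ≡⟨ count-shift-elems starts-block n ⟨
        bit (starts-block (- (+ n))) ℕ.+ count next-starts (elems n)  ≡⟨ cong (λ b → bit b ℕ.+ count next-starts (elems n)) lowest-starts-block ⟩
        suc (count next-starts (elems n))                            ∎

open import Data.Nat using (ℕ; suc; _+_; _*_; _∸_; _≤_; _<_; s≤s; z≤n; s≤s⁻¹)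
import Data.Nat.Properties as ℕₚ
open import Data.Nat.Tactic.RingSolver using (solve-∀)
open import Data.Product using (_×_; _,_; ∃-syntax)
open import Relation.Binary.PropositionalEquality using (_≡_; trans; cong; sym; module ≡-Reasoning)
open PlusMap using (module PlusArcs; module PlusPartition)

rank-complement : ∀ n k r → r + (2 * k + 1) ≡ 2 + (n + n) → r ≡ 2 * (n ∸ k) + 1
rank-complement n k r sum = ℕₚ.+-cancelʳ-≡ (2 * k + 1) r (2 * (n ∸ k) + 1) (begin
  r + (2 * k + 1)                       ≡⟨ sum ⟩
  2 + (n + n)                           ≡⟨ cong (λ m → 2 + (m + m)) (ℕₚ.m+[n∸m]≡n k≤n) ⟨
  2 + ((k + (n ∸ k)) + (k + (n ∸ k)))   ≡⟨ regroup k (n ∸ k) ⟩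
  (2 * (n ∸ k) + 1) + (2 * k + 1)       ∎)
  where
  open ≡-Reasoning
  regroup : ∀ k d → 2 + ((k + d) + (k + d)) ≡ (2 * d + 1) + (2 * k + 1)
  regroup = solve-∀
  double-suc : ∀ n → 2 + (n + n) ≡ 2 * suc n
  double-suc = solve-∀
  -- 2k < 2k + 1 ≤ r + (2k + 1) = 2(n + 1)
  2k<2[1+n] : 2 * k < 2 * suc n
  2k<2[1+n] = ℕₚ.<-≤-trans (ℕₚ.m<m+n (2 * k) (s≤s z≤n))
                (ℕₚ.≤-trans (ℕₚ.m≤n+m (2 * k + 1) r) (ℕₚ.≤-reflexive (trans sum (double-suc n))))
  k≤n : k ≤ n
  k≤n = s≤s⁻¹ (ℕₚ.*-cancelˡ-< 2 k (suc n) 2k<2[1+n])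

proposition5p1 : ∀ (n k : ℕ) (Λ : Partition n) → InNCB Λ → #blocks Λ ≡ 2 * k + 1 →
    (∃[ Λ⁺ ] IsPlus Λ Λ⁺)
    × (∀ (Λ⁺ : Partition n) → IsPlus Λ Λ⁺ → InNCB Λ⁺ × #blocks Λ⁺ ≡ 2 * (n ∸ k) + 1)
proposition5p1 n k Λ nc #Λ = PlusArcs.plus-exists Λ nc , properties
  where
  properties : ∀ (Λ⁺ : Partition n) → IsPlus Λ Λ⁺ → InNCB Λ⁺ × #blocks Λ⁺ ≡ 2 * (n ∸ k) + 1
  properties Λ⁺ plus = (symmetric⁺ , noncrossing⁺) ,
                       rank-complement n k (#blocks Λ⁺) (trans (cong (#blocks Λ⁺ +_) (sym #Λ)) block-count⁺)
    where open PlusPartition Λ nc Λ⁺ plus
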